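{- Let $G=(V,E)$ be a strongly connected digraph, $s\in V$, let $H$ be the auxiliary graph of the flow graph $G_s$ and $H'$ the auxiliary graph of the reverse flow graph $G^R_s$. Let $u,v\in V$, let $e_u$ be the first edge among the edges contained in every path from $u$ to $s$ in $G$ (if any), and $e_v$ the last edge among the edges contained in every path from $s$ to $v$ in $G$ (if any). Then: (1) if $e_v$ exists, then there is a path from $u$ to $v$ in $G\setminus e_v$ if and only if there is a path from $u$ to $v$ in $H$; (2) if $e_u$ exists, then there is a path from $u$ to $v$ in $G\setminus e_u$ if and only if there is a path from $v$ to $u$ in $H'$.
   Context: $G^R$ is $G$ with all edges reversed; $G_s$ and $G^R_s$ are $G$ and $G^R$ with start vertex $s$. For a flow graph $F_s$ with vertex set $V$ and edge set $E_F$: a vertex $a$ dominates $b$ if every path from $s$ to $b$ in $F$ contains $a$; the dominator tree $D$ is the rooted tree on $V$ (root $s$) in which $a$ is an ancestor of $b$ iff $a$ dominates $b$; $D(b)$ is the set of descendants of $b$ in $D$ (including $b$). An edge $(x,y)$ is a bridge of $F_s$ if every path from $s$ to $y$ in $F$ contains it. The auxiliary graph of $F_s$ is the digraph $(V,E')$ where $E'$ starts as $E_F$ minus the bridges of $F_s$, and then for every bridge $(p,q)$ of $F_s$ and every edge $(x,y)\in E_F$ with $x\in D(q)$, $y\notin D(q)$, the edge $(p,y)$ is added. The edges on all paths between two given vertices appear in the same order on all such paths, so "first" and "last" are well defined. $G\setminus e$ is $G$ with edge $e$ deleted. -}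

module Defs where

open import Data.Nat using (ℕ)
open import Data.Fin using (Fin)
open import Data.List using (List; []; _∷_; _++_)
open import Data.List.Membership.Propositional using (_∈_; _∉_)
open import Data.List.Relation.Unary.Unique.Propositional using (Unique)
open import Data.Product using (Σ; _×_; _,_; ∃; ∃-syntax)
open import Data.Sum using (_⊎_)
open import Relation.Binary.PropositionalEquality using (_≡_)
open import Relation.Nullary using (¬_)
open import Relation.Binary.Construct.Closure.ReflexiveTransitive using (Star)

record Digraph : Set where
  field
    n   : ℕ
    m   : ℕ
    src : Fin m → Fin n
    tgt : Fin m → Fin n

open Digraph public

V : Digraph → Set
V G = Fin (n G)

E : Digraph → Set
E G = Fin (m G)

reverse : Digraph → Digraph
reverse G = record { n = n G ; m = m G ; src = tgt G ; tgt = src G }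

data Walk (G : Digraph) : V G → V G → Set where
  []  : ∀ {x} → Walk G x x
  _∷⟨_⟩_ : ∀ {x y} (e : E G) → src G e ≡ x → Walk G (tgt G e) y → Walk G x y

edgesOf : ∀ {G x y} → Walk G x y → List (E G)
edgesOf [] = []
edgesOf (e ∷⟨ _ ⟩ w) = e ∷ edgesOf w

vertsOf : ∀ {G x y} → Walk G x y → List (V G)
vertsOf {x = x} [] = x ∷ []
vertsOf {x = x} (e ∷⟨ _ ⟩ w) = x ∷ vertsOf w

IsPath : ∀ {G x y} → Walk G x y → Set
IsPath w = Unique (vertsOf w)

ReachWithout : (G : Digraph) → E G → V G → V G → Set
ReachWithout G e x y = Σ (Walk G x y) λ w → e ∉ edgesOf w

StronglyConnected : Digraph → Set
StronglyConnected G = ∀ (x y : V G) → Walk G x y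

Dominates : (F : Digraph) (s : V F) → V F → V F → Set
Dominates F s a b = ∀ (w : Walk F s b) → IsPath w → a ∈ vertsOf w

-- b ∈ D(q) : b is a descendant of q in the dominator tree (q dominates b).
InD : (F : Digraph) (s : V F) → V F → V F → Set
InD F s q b = Dominates F s q b

Bridge : (F : Digraph) (s : V F) → E F → Set
Bridge F s e = ∀ (w : Walk F s (tgt F e)) → IsPath w → e ∈ edgesOf w

AuxEdge : (F : Digraph) (s : V F) → V F → V F → Set
AuxEdge F s x y =
    (Σ (E F) λ e → ¬ Bridge F s e × src F e ≡ x × tgt F e ≡ y)
  ⊎ (Σ (E F) λ b → Σ (E F) λ f →
        Bridge F s b × src F b ≡ x
      × InD F s (tgt F b) (src F f) × ¬ InD F s (tgt F b) (tgt F f)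
      × tgt F f ≡ y)

AuxReach : (F : Digraph) (s : V F) → V F → V F → Set
AuxReach F s = Star (AuxEdge F s)

OnEveryPath : (G : Digraph) → V G → V G → E G → Set
OnEveryPath G x y e = ∀ (w : Walk G x y) → IsPath w → e ∈ edgesOf w

IsLastOnEveryPath : (G : Digraph) → V G → V G → E G → Set
IsLastOnEveryPath G x y e =
  OnEveryPath G x y e ×
  (∀ (w : Walk G x y) → IsPath w →
     ∃[ p₁ ] ∃[ p₂ ] (edgesOf w ≡ p₁ ++ e ∷ p₂ × (∀ f → OnEveryPath G x y f → f ∉ p₂)))

IsFirstOnEveryPath : (G : Digraph) → V G → V G → E G → Set
IsFirstOnEveryPath G x y e =
  OnEveryPath G x y e ×
  (∀ (w : Walk G x y) → IsPath w →
     ∃[ p₁ ] ∃[ p₂ ] (edgesOf w ≡ p₁ ++ e ∷ p₂ × (∀ f → OnEveryPath G x y f → f ∉ p₁)))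

module Submission where

-- Let e, with target q, be the last edge common to all s–v paths. Then e is a bridge of G_s, q dominates v,
-- and the proof of (1) rests on the invariant: x reaches v in H iff q dominates x and x reaches v in
-- G ∖ e. Going backwards along an H-path, each H-edge (x, y) lifts to a walk x ⇝ y in G ∖ e, and q
-- dominating y forces q to dominate x (dominators of a vertex are totally ordered). Conversely, along
-- a walk in G ∖ e every non-bridge edge is an H-edge; at a bridge (x, y) ≠ e the vertex y cannot
-- dominate v, so the walk eventually leaves D(y) through some edge (z, w), and (x, w) is an H-edge.
-- Part (2) is part (1) for Gᴿ: reversing paths turns the first common edge of the u–s paths in G
-- into the last common edge of the s–u paths in Gᴿ.

open import Defs
open import Data.Nat using (zero; suc; _≤_; z≤n; s≤s)
open import Data.Nat.Properties using (≤-trans; n≤1+n; ≰⇒>; _≤?_)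
open import Data.Fin using (Fin; _≟_)
import Data.Fin as Fin
open import Data.Fin.Properties using (any?; pigeonhole; <⇒≢)
open import Data.List using (List; []; _∷_; _++_; length; lookup; map)
import Data.List as List
open import Data.List.Properties
  using (map-++; unfold-reverse; reverse-++; reverse-involutive; ++-assoc; ∷-injectiveʳ)
open import Data.List.Membership.Propositional using (_∈_; _∉_)
open import Data.List.Membership.Propositional.Properties using (∈-lookup; ∈-++⁺ˡ; ∈-++⁺ʳ; ∈-++⁻; ∈-map⁺)
open import Data.List.Membership.DecPropositional using () renaming (_∈?_ to ∈?)
open import Data.List.Relation.Unary.Any using (here; there)
import Data.List.Relation.Unary.Any.Properties as Any
open import Data.List.Relation.Unary.All as All using (All; []; _∷_)
open import Data.List.Relation.Unary.All.Properties using (¬Any⇒All¬; All¬⇒¬Any)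
open import Data.List.Relation.Unary.Unique.Propositional using (Unique; []; _∷_)
import Data.List.Relation.Unary.Unique.Propositional.Properties as Unique
open import Data.List.Relation.Binary.Disjoint.Propositional using (Disjoint)
open import Data.List.Relation.Binary.Subset.Propositional using (_⊆_)
import Data.List.Relation.Binary.Subset.Propositional.Properties as ⊆
open import Data.Product using (Σ; ∃₂; ∃-syntax; _×_; _,_; proj₁; proj₂)
open import Data.Sum using (_⊎_; inj₁; inj₂; [_,_]′)
open import Data.Empty using (⊥-elim)
open import Function using (_∘_; id)
open import Function.Bundles using (_⇔_; mk⇔)
open import Function.Construct.Composition using (_⇔-∘_)
open import Level using (0ℓ)
open import Relation.Nullary using (Dec; yes; no; ¬_; ¬?)
open import Relation.Nullary.Decidable using (_×-dec_; decidable-stable)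
open import Relation.Unary using (Pred; Decidable)
open import Relation.Binary.PropositionalEquality using (_≡_; refl; sym; trans; cong; subst; module ≡-Reasoning)
open import Relation.Binary.Construct.Closure.ReflexiveTransitive using (ε; _◅_)

module _ {A : Set} where

  Unique-++⁻ : ∀ xs {ys : List A} → Unique (xs ++ ys) → Unique ys × Disjoint xs ys
  Unique-++⁻ []       u        = u , λ ()
  Unique-++⁻ (x ∷ xs) (x∉ ∷ u) with Unique-++⁻ xs u
  ... | u′ , disj = u′ , λ where
    (here refl , y∈) → All.lookup x∉ (∈-++⁺ʳ xs y∈) refl
    (there z∈ , y∈)  → disj (z∈ , y∈)

  Unique-reverse : ∀ {xs : List A} → Unique xs → Unique (List.reverse xs)
  Unique-reverse [] = []
  Unique-reverse {x ∷ xs} (x∉ ∷ u) rewrite unfold-reverse x xs =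
    Unique.++⁺ (Unique-reverse u) (All.[] ∷ []) λ { (x∈ , here refl) → All.lookup x∉ (Any.reverse⁻ x∈) refl }

  Unique-lookup-injective : ∀ {xs : List A} {i j} → Unique xs → lookup xs i ≡ lookup xs j → i ≡ j
  Unique-lookup-injective {x ∷ xs} {Fin.zero}  {Fin.zero}  _        _  = refl
  Unique-lookup-injective {x ∷ xs} {Fin.zero}  {Fin.suc j} (x∉ ∷ _) eq = ⊥-elim (All.lookup x∉ (∈-lookup j) eq)
  Unique-lookup-injective {x ∷ xs} {Fin.suc i} {Fin.zero}  (x∉ ∷ _) eq = ⊥-elim (All.lookup x∉ (∈-lookup i) (sym eq))
  Unique-lookup-injective {x ∷ xs} {Fin.suc i} {Fin.suc j} (_ ∷ u)  eq = cong Fin.suc (Unique-lookup-injective u eq)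

  later⇒∈-suffix : ∀ (xs : List A) {ys p₁ p₂ f e} → Unique (xs ++ f ∷ ys) →
                   xs ++ f ∷ ys ≡ p₁ ++ e ∷ p₂ → e ∈ xs → f ∈ p₂
  later⇒∈-suffix (x ∷ xs) {p₁ = []}     _        eq _ rewrite sym (∷-injectiveʳ eq) = ∈-++⁺ʳ xs (here refl)
  later⇒∈-suffix (x ∷ xs) {p₁ = _ ∷ p₁} (x∉ ∷ _) eq (here refl) =
    ⊥-elim (All.lookup x∉ (subst (x ∈_) (sym (∷-injectiveʳ eq)) (∈-++⁺ʳ p₁ (here refl))) refl)
  later⇒∈-suffix (x ∷ xs) {p₁ = _ ∷ p₁} (_ ∷ u)  eq (there e∈) = later⇒∈-suffix xs u (∷-injectiveʳ eq) e∈

Unique⇒length≤ : ∀ {k} {xs : List (Fin k)} → Unique xs → length xs ≤ k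
Unique⇒length≤ {k} {xs} u with length xs ≤? k
... | yes ≤k = ≤k
... | no ≰k with pigeonhole (≰⇒> ≰k) (lookup xs)
...   | i , j , i<j , eq = ⊥-elim (<⇒≢ i<j (Unique-lookup-injective u eq))

module Walks (G : Digraph) where

  infixr 5 _++ᵂ_

  _++ᵂ_ : ∀ {x y z} → Walk G x y → Walk G y z → Walk G x z
  []             ++ᵂ w₂ = w₂
  (e ∷⟨ p ⟩ w₁) ++ᵂ w₂ = e ∷⟨ p ⟩ (w₁ ++ᵂ w₂)

  edge : ∀ f → Walk G (src G f) (tgt G f)
  edge f = f ∷⟨ refl ⟩ []

  targets : ∀ {x y} → Walk G x y → List (V G)
  targets w = map (tgt G) (edgesOf w)

  vertsOf≡∷targets : ∀ {x y} (w : Walk G x y) → vertsOf w ≡ x ∷ targets w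
  vertsOf≡∷targets []               = refl
  vertsOf≡∷targets {x} (e ∷⟨ _ ⟩ w) = cong (x ∷_) (vertsOf≡∷targets w)

  edgesOf-++ᵂ : ∀ {x y z} (w₁ : Walk G x y) (w₂ : Walk G y z) →
                edgesOf (w₁ ++ᵂ w₂) ≡ edgesOf w₁ ++ edgesOf w₂
  edgesOf-++ᵂ []            w₂ = refl
  edgesOf-++ᵂ (e ∷⟨ _ ⟩ w₁) w₂ = cong (e ∷_) (edgesOf-++ᵂ w₁ w₂)

  vertsOf-++ᵂ : ∀ {x y z} (w₁ : Walk G x y) (w₂ : Walk G y z) →
                vertsOf (w₁ ++ᵂ w₂) ≡ vertsOf w₁ ++ targets w₂
  vertsOf-++ᵂ []                w₂ = vertsOf≡∷targets w₂
  vertsOf-++ᵂ {x} (e ∷⟨ _ ⟩ w₁) w₂ = cong (x ∷_) (vertsOf-++ᵂ w₁ w₂)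

  targets-++ᵂ : ∀ {x y z} (w₁ : Walk G x y) (w₂ : Walk G y z) →
                targets (w₁ ++ᵂ w₂) ≡ targets w₁ ++ targets w₂
  targets-++ᵂ w₁ w₂ = trans (cong (map (tgt G)) (edgesOf-++ᵂ w₁ w₂)) (map-++ (tgt G) (edgesOf w₁) (edgesOf w₂))

  ∈-edgesOf-++ᵂ⁻ : ∀ {x y z f} (w₁ : Walk G x y) (w₂ : Walk G y z) →
                   f ∈ edgesOf (w₁ ++ᵂ w₂) → f ∈ edgesOf w₁ ⊎ f ∈ edgesOf w₂
  ∈-edgesOf-++ᵂ⁻ w₁ w₂ f∈ = ∈-++⁻ (edgesOf w₁) (subst (_ ∈_) (edgesOf-++ᵂ w₁ w₂) f∈)

  ∈-vertsOf-++ᵂ⁻ : ∀ {x y z a} (w₁ : Walk G x y) (w₂ : Walk G y z) →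
                   a ∈ vertsOf (w₁ ++ᵂ w₂) → a ∈ vertsOf w₁ ⊎ a ∈ targets w₂
  ∈-vertsOf-++ᵂ⁻ w₁ w₂ a∈ = ∈-++⁻ (vertsOf w₁) (subst (_ ∈_) (vertsOf-++ᵂ w₁ w₂) a∈)

  start∈vertsOf : ∀ {x y} (w : Walk G x y) → x ∈ vertsOf w
  start∈vertsOf []            = here refl
  start∈vertsOf (_ ∷⟨ _ ⟩ _) = here refl

  end∈vertsOf : ∀ {x y} (w : Walk G x y) → y ∈ vertsOf w
  end∈vertsOf []            = here refl
  end∈vertsOf (_ ∷⟨ _ ⟩ w) = there (end∈vertsOf w)

  targets⊆vertsOf : ∀ {x y} (w : Walk G x y) → targets w ⊆ vertsOf w
  targets⊆vertsOf w a∈ = subst (_ ∈_) (sym (vertsOf≡∷targets w)) (there a∈)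

  tgt∈targets : ∀ {x y f} (w : Walk G x y) → f ∈ edgesOf w → tgt G f ∈ targets w
  tgt∈targets w = ∈-map⁺ (tgt G)

  src∈vertsOf : ∀ {x y f} (w : Walk G x y) → f ∈ edgesOf w → src G f ∈ vertsOf w
  src∈vertsOf (e ∷⟨ refl ⟩ w) (here refl) = here refl
  src∈vertsOf (e ∷⟨ _ ⟩ w)    (there f∈)  = there (src∈vertsOf w f∈)

  splitAtVertex : ∀ {x y c} (w : Walk G x y) → c ∈ vertsOf w →
                  ∃₂ λ (A : Walk G x c) (B : Walk G c y) → w ≡ A ++ᵂ B
  splitAtVertex []            (here refl) = [] , [] , refl
  splitAtVertex (e ∷⟨ p ⟩ w) (here refl) = [] , e ∷⟨ p ⟩ w , refl
  splitAtVertex (e ∷⟨ p ⟩ w) (there c∈) with splitAtVertex w c∈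
  ... | A , B , refl = e ∷⟨ p ⟩ A , B , refl

  splitAtEdge : ∀ {x y f} (w : Walk G x y) → f ∈ edgesOf w →
                ∃₂ λ (A : Walk G x (src G f)) (B : Walk G (tgt G f) y) → w ≡ A ++ᵂ f ∷⟨ refl ⟩ B
  splitAtEdge (e ∷⟨ refl ⟩ w) (here refl) = [] , w , refl
  splitAtEdge (e ∷⟨ p ⟩ w)    (there f∈) with splitAtEdge w f∈
  ... | A , B , refl = e ∷⟨ p ⟩ A , B , refl

  start∉targets : ∀ {x y} (w : Walk G x y) → IsPath w → x ∉ targets w
  start∉targets w u = Unique.Unique[x∷xs]⇒x∉xs (subst Unique (vertsOf≡∷targets w) u)

  IsPath-++ᵂ⁻ : ∀ {x y z} (A : Walk G x y) (B : Walk G y z) → IsPath (A ++ᵂ B) →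
                IsPath B × Disjoint (vertsOf A) (targets B)
  IsPath-++ᵂ⁻ A B u with Unique-++⁻ (vertsOf A) (subst Unique (vertsOf-++ᵂ A B) u)
  ... | uB , disj = subst Unique (sym (vertsOf≡∷targets B)) (end∉ ∷ uB) , disj
    where end∉ = ¬Any⇒All¬ (targets B) λ y∈ → disj (end∈vertsOf A , y∈)

  vertsOf-⊆ : ∀ {x y} {w₁ w₂ : Walk G x y} → edgesOf w₁ ⊆ edgesOf w₂ → vertsOf w₁ ⊆ vertsOf w₂
  vertsOf-⊆ {x} {w₁ = w₁} {w₂} sub
    rewrite vertsOf≡∷targets w₁ | vertsOf≡∷targets w₂ = ⊆.∷⁺ʳ x (⊆.map⁺ (tgt G) sub)

  toPath : ∀ {x y} (w : Walk G x y) → Σ (Walk G x y) λ P → IsPath P × edgesOf P ⊆ edgesOf w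
  toPath [] = [] , [] ∷ [] , λ ()
  toPath {x} (e ∷⟨ p ⟩ w) with toPath w
  ... | P , uP , P⊆w with ∈? _≟_ x (vertsOf P)
  ...   | no x∉ = e ∷⟨ p ⟩ P , ¬Any⇒All¬ _ x∉ ∷ uP , ⊆.∷⁺ʳ e P⊆w
  ...   | yes x∈ with splitAtVertex P x∈
  ...     | A , B , refl = B , proj₁ (IsPath-++ᵂ⁻ A B uP) , there ∘ P⊆w ∘ B⊆A++B
    where B⊆A++B = subst (edgesOf B ⊆_) (sym (edgesOf-++ᵂ A B)) (⊆.xs⊆ys++xs (edgesOf B) (edgesOf A))

  length-vertsOf : ∀ {x y} (w : Walk G x y) → length (vertsOf w) ≡ suc (length (edgesOf w))
  length-vertsOf []            = refl
  length-vertsOf (_ ∷⟨ _ ⟩ w) = cong suc (length-vertsOf w)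

  path-length≤ : ∀ {x y} (w : Walk G x y) → IsPath w → length (edgesOf w) ≤ n G
  path-length≤ w u = ≤-trans (n≤1+n _) (subst (_≤ n G) (length-vertsOf w) (Unique⇒length≤ u))

  IsPath⇒Unique-edgesOf : ∀ {x y} (w : Walk G x y) → IsPath w → Unique (edgesOf w)
  IsPath⇒Unique-edgesOf w u with subst Unique (vertsOf≡∷targets w) u
  ... | _ ∷ u′ = Unique.map⁻ u′

  reachWithout-edge : ∀ {e f} → ¬ f ≡ e → ReachWithout G e (src G f) (tgt G f)
  reachWithout-edge f≢e = edge _ , λ { (here e≡f) → f≢e (sym e≡f) }

  infixr 5 _⊕_

  _⊕_ : ∀ {e x y z} → ReachWithout G e x y → ReachWithout G e y z → ReachWithout G e x z
  (w₁ , e∉w₁) ⊕ (w₂ , e∉w₂) = w₁ ++ᵂ w₂ , [ e∉w₁ , e∉w₂ ]′ ∘ ∈-edgesOf-++ᵂ⁻ w₁ w₂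

  OnEveryWalk : V G → V G → E G → Set
  OnEveryWalk x y f = ∀ (w : Walk G x y) → f ∈ edgesOf w

  OnEveryPath⇒OnEveryWalk : ∀ {x y f} → OnEveryPath G x y f → OnEveryWalk x y f
  OnEveryPath⇒OnEveryWalk oe w = let (P , uP , P⊆w) = toPath w in P⊆w (oe P uP)

  -- The case splits on dominance and bridges are decided by this search; it is complete because
  -- any walk shortens to a path, which has fewer than n edges.
  module _ {P : Pred (E G) 0ℓ} (P? : Decidable P) where

    WalkWithin : V G → V G → Set
    WalkWithin x y = Σ (Walk G x y) λ w → All P (edgesOf w)

    walkWithin≤? : ∀ k x y → Dec (Σ (WalkWithin x y) λ (w , _) → length (edgesOf w) ≤ k)
    walkWithin≤? k x y with x ≟ y
    ... | yes refl = yes (([] , []) , z≤n)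
    walkWithin≤? zero x y | no x≢y = no λ where
      (([] , _) , _) → x≢y refl
      ((_ ∷⟨ _ ⟩ _ , _) , ())
    walkWithin≤? (suc k) x y | no x≢y
      with any? (λ f → (src G f ≟ x) ×-dec P? f ×-dec walkWithin≤? k (tgt G f) y)
    ... | yes (f , refl , pf , (w , pw) , ≤k) = yes ((f ∷⟨ refl ⟩ w , pf ∷ pw) , s≤s ≤k)
    ... | no ∄f = no λ where
      (([] , _) , _) → x≢y refl
      ((f ∷⟨ sx ⟩ w , pf ∷ pw) , s≤s ≤k) → ∄f (f , sx , pf , (w , pw) , ≤k)

    walkWithin? : ∀ x y → Dec (WalkWithin x y)
    walkWithin? x y with walkWithin≤? (n G) x y
    ... | yes (ww , _) = yes ww
    ... | no ∄w = no λ (w , pw) → let (P , uP , P⊆w) = toPath w in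
                    ∄w ((P , ⊆.All-resp-⊇ P⊆w pw) , path-length≤ P uP)

module Dominators (G : Digraph) (s : V G) where
  open Walks G

  -- Dominance and bridges over all walks rather than paths (equivalent via toPath), so that they
  -- can be tested on concatenations of walks.
  infix 4 _dom_

  _dom_ : V G → V G → Set
  a dom b = ∀ (w : Walk G s b) → a ∈ vertsOf w

  IsBridge : E G → Set
  IsBridge f = OnEveryWalk s (tgt G f) f

  dom⇒Dominates : ∀ {a b} → a dom b → Dominates G s a b
  dom⇒Dominates d w _ = d w

  IsBridge⇒Bridge : ∀ {f} → IsBridge f → Bridge G s f
  IsBridge⇒Bridge br w _ = br w

  Bridge⇒IsBridge : ∀ {f} → Bridge G s f → IsBridge f
  Bridge⇒IsBridge = OnEveryPath⇒OnEveryWalk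

  Dominates⇒dom : ∀ {a b} → Dominates G s a b → a dom b
  Dominates⇒dom d w = let (P , uP , P⊆w) = toPath w in vertsOf-⊆ P⊆w (d P uP)

  dom-refl : ∀ {a} → a dom a
  dom-refl = end∈vertsOf

  dom-trans : ∀ {a b c} → a dom b → b dom c → a dom c
  dom-trans a-b b-c w with splitAtVertex w (b-c w)
  ... | A , B , refl = subst (_ ∈_) (sym (vertsOf-++ᵂ A B)) (∈-++⁺ˡ (a-b A))

  bridge-src-dom-tgt : ∀ {f} → IsBridge f → src G f dom tgt G f
  bridge-src-dom-tgt br w = src∈vertsOf w (br w)

  bridge-dom⇒OnEveryWalk : ∀ {f b} → IsBridge f → tgt G f dom b → OnEveryWalk s b f
  bridge-dom⇒OnEveryWalk br d w with splitAtVertex w (d w)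
  ... | A , B , refl = subst (_ ∈_) (sym (edgesOf-++ᵂ A B)) (∈-++⁺ˡ (br A))

  dom-comparable : ∀ {a b z} → Walk G s z → a dom z → b dom z → b dom a ⊎ a dom b
  dom-comparable w a-z b-z with toPath w
  ... | P , uP , _ with splitAtVertex P (a-z P)
  ...   | A , B , refl with IsPath-++ᵂ⁻ A B uP
  ...     | _ , disj with ∈-vertsOf-++ᵂ⁻ A B (b-z (A ++ᵂ B))
  ...       | inj₁ b∈A = inj₁ λ W → [ id , (λ b∈B → ⊥-elim (disj (b∈A , b∈B))) ]′
                                        (∈-vertsOf-++ᵂ⁻ W B (b-z (W ++ᵂ B)))
  ...       | inj₂ b∈B with splitAtVertex B (targets⊆vertsOf B b∈B)
  ...         | B₁ , B₂ , refl = inj₂ λ W → [ id , (λ a∈B₂ → ⊥-elim (disj (end∈vertsOf A , a∈B a∈B₂))) ]′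
                                                (∈-vertsOf-++ᵂ⁻ W B₂ (a-z (W ++ᵂ B₂)))
    where a∈B = λ a∈B₂ → subst (_ ∈_) (sym (targets-++ᵂ B₁ B₂)) (∈-++⁺ʳ (targets B₁) a∈B₂)

  -- a dom b iff a ≡ s or no walk from s to b enters a.
  _dom?_ : ∀ a b → Dec (a dom b)
  a dom? b with s ≟ a
  ... | yes refl = yes start∈vertsOf
  ... | no s≢a with walkWithin? (λ f → ¬? (a ≟ tgt G f)) s b
  ...   | yes (w , misses-a) = no λ a-b → misses-a⇒a∉ w misses-a (a-b w)
    where
      misses-a⇒a∉ : (w : Walk G s b) → All (λ f → ¬ a ≡ tgt G f) (edgesOf w) → a ∉ vertsOf w
      misses-a⇒a∉ w misses-a a∈ with subst (a ∈_) (vertsOf≡∷targets w) a∈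
      ... | here a≡s  = s≢a (sym a≡s)
      ... | there a∈′ = All¬⇒¬Any misses-a (Any.map⁻ a∈′)
  ...   | no ∄w = yes λ w → decidable-stable (∈? _≟_ a (vertsOf w)) λ a∉ →
                    ∄w (w , ¬Any⇒All¬ (edgesOf w) (a∉ ∘ targets⊆vertsOf w ∘ Any.map⁺))

  isBridge? : ∀ f → Dec (IsBridge f)
  isBridge? f with walkWithin? (λ g → ¬? (f ≟ g)) s (tgt G f)
  ... | yes (w , misses-f) = no λ br → All¬⇒¬Any misses-f (br w)
  ... | no ∄w = yes λ w → decidable-stable (∈? _≟_ f (edgesOf w)) λ f∉ → ∄w (w , ¬Any⇒All¬ (edgesOf w) f∉)

module LastEdge (G : Digraph) (s : V G) (reachable : ∀ z → Walk G s z)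
                (v : V G) (e : E G) (last : IsLastOnEveryPath G s v e) where
  open Walks G
  open Dominators G s

  q : V G
  q = tgt G e

  e-on-every-walk : OnEveryWalk s v e
  e-on-every-walk = OnEveryPath⇒OnEveryWalk (proj₁ last)

  e-bridge : IsBridge e
  e-bridge w with toPath (reachable v)
  ... | P , uP , _ with splitAtEdge P (e-on-every-walk P)
  ...   | A , B , refl with IsPath-++ᵂ⁻ A (e ∷⟨ refl ⟩ B) uP
  ...     | _ ∷ uB , _ with ∈-edgesOf-++ᵂ⁻ w B (e-on-every-walk (w ++ᵂ B))
  ...       | inj₁ e∈w = e∈w
  ...       | inj₂ e∈B = ⊥-elim (start∉targets B uB (tgt∈targets B e∈B))

  q-dom-v : q dom v
  q-dom-v w = targets⊆vertsOf w (tgt∈targets w (e-on-every-walk w))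

  q-dom-src : ∀ {f} → ¬ f ≡ e → q dom tgt G f → q dom src G f
  q-dom-src {f} f≢e q-y w with ∈-vertsOf-++ᵂ⁻ w (edge f) (q-y (w ++ᵂ edge f))
  ... | inj₁ q∈w = q∈w
  ... | inj₂ (here q≡y) with ∈-edgesOf-++ᵂ⁻ w (edge f) (subst (λ z → OnEveryWalk s z e) q≡y e-bridge (w ++ᵂ edge f))
  ...   | inj₁ e∈w = targets⊆vertsOf w (tgt∈targets w e∈w)
  ...   | inj₂ (here e≡f) = ⊥-elim (f≢e (sym e≡f))

  q-dom-start : ∀ {a} (w : Walk G a v) → e ∉ edgesOf w → q dom a
  q-dom-start []              _  = q-dom-v
  q-dom-start (f ∷⟨ refl ⟩ w) e∉ = q-dom-src (λ { refl → e∉ (here refl) }) (q-dom-start w (e∉ ∘ there))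

  reach-below-q : ∀ {a z} → q dom a → a dom z → ReachWithout G e a z
  reach-below-q {z = z} q-a a-z with toPath (reachable z)
  ... | P , uP , _ with splitAtVertex P (a-z P)
  ...   | A , B , refl = B , λ e∈B → proj₂ (IsPath-++ᵂ⁻ A B uP) (q-a A , tgt∈targets B e∈B)

  auxEdge-sound : ∀ {x y} → AuxEdge G s x y → q dom y → q dom x × ReachWithout G e x y
  auxEdge-sound (inj₁ (f , ¬br , refl , refl)) q-y = q-dom-src f≢e q-y , reachWithout-edge f≢e
    where
      f≢e : ¬ f ≡ e
      f≢e refl = ¬br (IsBridge⇒Bridge e-bridge)
  auxEdge-sound (inj₂ (b , f , _ , refl , z∈D , y∉D , refl)) q-y =
    q-dom-src b≢e q-q′ , reachWithout-edge b≢e ⊕ reach-below-q q-q′ q′-z ⊕ reachWithout-edge f≢e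
    where
      q′-z : tgt G b dom src G f
      q′-z = Dominates⇒dom z∈D
      ¬q′-y : ¬ tgt G b dom tgt G f
      ¬q′-y = y∉D ∘ dom⇒Dominates
      f≢e : ¬ f ≡ e
      f≢e refl = ¬q′-y (dom-trans q′-z (bridge-src-dom-tgt e-bridge))
      b≢e : ¬ b ≡ e
      b≢e refl = ¬q′-y q-y
      q-q′ : q dom tgt G b
      q-q′ with dom-comparable (reachable (src G f)) (q-dom-src f≢e q-y) q′-z
      ... | inj₁ q′-q = ⊥-elim (¬q′-y (dom-trans q′-q q-y))
      ... | inj₂ q-q′ = q-q′

  auxReach-sound : ∀ {x} → AuxReach G s x v → q dom x × ReachWithout G e x v
  auxReach-sound ε = q-dom-v , [] , λ ()
  auxReach-sound (r ◅ rs) with auxReach-sound rs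
  ... | q-y , y⇝v with auxEdge-sound r q-y
  ...   | q-x , x⇝y = q-x , x⇝y ⊕ y⇝v

  e∉before : ∀ {f} → OnEveryWalk s v f → (A : Walk G s (src G f)) (B : Walk G (tgt G f) v) →
             IsPath (A ++ᵂ f ∷⟨ refl ⟩ B) → e ∉ edgesOf A
  e∉before {f} f-every A B uP e∈A with proj₂ last (A ++ᵂ f ∷⟨ refl ⟩ B) uP
  ... | p₁ , p₂ , edges≡ , p₂-free =
    p₂-free f (λ w _ → f-every w) (later⇒∈-suffix (edgesOf A) unique (trans (sym split) edges≡) e∈A)
    where
      split = edgesOf-++ᵂ A (f ∷⟨ refl ⟩ B)
      unique = subst Unique split (IsPath⇒Unique-edgesOf _ uP)

  e∉after : ∀ {f} → q dom tgt G f → (A : Walk G s (src G f)) (B : Walk G (tgt G f) v) →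
            IsPath (A ++ᵂ f ∷⟨ refl ⟩ B) → e ∉ edgesOf B
  e∉after {f} q-y A B uP e∈B with IsPath-++ᵂ⁻ A (f ∷⟨ refl ⟩ B) uP
  ... | _ ∷ uB , disj with ∈-vertsOf-++ᵂ⁻ A (edge f) (q-y (A ++ᵂ edge f))
  ...   | inj₁ q∈A        = disj (q∈A , there (tgt∈targets B e∈B))
  ...   | inj₂ (here q≡y) = start∉targets B uB (subst (_∈ targets B) q≡y (tgt∈targets B e∈B))

  -- Otherwise f would lie on every s–v path, and on such a path e could neither precede f
  -- (e is the last common edge) nor follow it (q dominates tgt f, so q would occur twice).
  bridge-tgt-¬dom-v : ∀ {f} → IsBridge f → ¬ f ≡ e → (w : Walk G (tgt G f) v) → e ∉ edgesOf w →
                      ¬ tgt G f dom v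
  bridge-tgt-¬dom-v {f} br f≢e w e∉w y-v with toPath (reachable v)
  ... | P , uP , _ with splitAtEdge P (bridge-dom⇒OnEveryWalk br y-v P)
  ...   | A , B , refl with ∈-edgesOf-++ᵂ⁻ A (f ∷⟨ refl ⟩ B) (e-on-every-walk (A ++ᵂ f ∷⟨ refl ⟩ B))
  ...     | inj₁ e∈A         = e∉before (bridge-dom⇒OnEveryWalk br y-v) A B uP e∈A
  ...     | inj₂ (here e≡f)  = f≢e (sym e≡f)
  ...     | inj₂ (there e∈B) = e∉after (q-dom-start w e∉w) A B uP e∈B

  mutual
    auxReach-complete : ∀ {a} (w : Walk G a v) → e ∉ edgesOf w → AuxReach G s a v
    auxReach-complete []              _  = ε
    auxReach-complete (f ∷⟨ refl ⟩ w) e∉ with isBridge? f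
    ... | no ¬br = inj₁ (f , ¬br ∘ Bridge⇒IsBridge , refl , refl) ◅ auxReach-complete w (e∉ ∘ there)
    ... | yes br = auxReach-leaving br (bridge-tgt-¬dom-v br f≢e w (e∉ ∘ there)) w (e∉ ∘ there) dom-refl
      where
        f≢e : ¬ f ≡ e
        f≢e refl = e∉ (here refl)

    -- The walk starts in D(tgt f) and ends outside it; its first edge g leaving D(tgt f)
    -- yields the auxiliary edge (src f, tgt g).
    auxReach-leaving : ∀ {f c} → IsBridge f → ¬ tgt G f dom v → (w : Walk G c v) → e ∉ edgesOf w →
                       tgt G f dom c → AuxReach G s (src G f) v
    auxReach-leaving br ¬y-v [] _ y-c = ⊥-elim (¬y-v y-c)
    auxReach-leaving {f} br ¬y-v (g ∷⟨ refl ⟩ w) e∉ y-c with tgt G f dom? tgt G g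
    ... | yes y-g = auxReach-leaving br ¬y-v w (e∉ ∘ there) y-g
    ... | no ¬y-g = inj₂ (f , g , IsBridge⇒Bridge br , refl , dom⇒Dominates y-c , ¬y-g ∘ Dominates⇒dom , refl)
                    ◅ auxReach-complete w (e∉ ∘ there)

  reachWithout⇔auxReach : ∀ u → ReachWithout G e u v ⇔ AuxReach G s u v
  reachWithout⇔auxReach u = mk⇔ (λ (w , e∉w) → auxReach-complete w e∉w) (proj₂ ∘ auxReach-sound)

module Reversal (G : Digraph) where
  open Walks (reverse G) using ()
    renaming (_++ᵂ_ to _++ᴿ_; edgesOf-++ᵂ to edgesOf-++ᴿ; vertsOf-++ᵂ to vertsOf-++ᴿ)

  reverseWalk : ∀ {x y} → Walk G x y → Walk (reverse G) y x
  reverseWalk []              = []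
  reverseWalk (e ∷⟨ refl ⟩ w) = reverseWalk w ++ᴿ e ∷⟨ refl ⟩ []

  edgesOf-reverseWalk : ∀ {x y} (w : Walk G x y) → edgesOf (reverseWalk w) ≡ List.reverse (edgesOf w)
  edgesOf-reverseWalk []              = refl
  edgesOf-reverseWalk (e ∷⟨ refl ⟩ w) = begin
    edgesOf (reverseWalk w ++ᴿ e ∷⟨ refl ⟩ []) ≡⟨ edgesOf-++ᴿ (reverseWalk w) _ ⟩
    edgesOf (reverseWalk w) ++ e ∷ []         ≡⟨ cong (_++ e ∷ []) (edgesOf-reverseWalk w) ⟩
    List.reverse (edgesOf w) ++ e ∷ []        ≡⟨ unfold-reverse e (edgesOf w) ⟨
    List.reverse (e ∷ edgesOf w)              ∎
    where open ≡-Reasoning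

  vertsOf-reverseWalk : ∀ {x y} (w : Walk G x y) → vertsOf (reverseWalk w) ≡ List.reverse (vertsOf w)
  vertsOf-reverseWalk []              = refl
  vertsOf-reverseWalk {x} (e ∷⟨ refl ⟩ w) = begin
    vertsOf (reverseWalk w ++ᴿ e ∷⟨ refl ⟩ []) ≡⟨ vertsOf-++ᴿ (reverseWalk w) _ ⟩
    vertsOf (reverseWalk w) ++ x ∷ []         ≡⟨ cong (_++ x ∷ []) (vertsOf-reverseWalk w) ⟩
    List.reverse (vertsOf w) ++ x ∷ []        ≡⟨ unfold-reverse x (vertsOf w) ⟨
    List.reverse (x ∷ vertsOf w)              ∎
    where open ≡-Reasoning

  reverseWalk-IsPath : ∀ {x y} (w : Walk G x y) → IsPath w → IsPath (reverseWalk w)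
  reverseWalk-IsPath w u = subst Unique (sym (vertsOf-reverseWalk w)) (Unique-reverse u)

  ∈-edgesOf-reverseWalk⁻ : ∀ {x y f} (w : Walk G x y) → f ∈ edgesOf (reverseWalk w) → f ∈ edgesOf w
  ∈-edgesOf-reverseWalk⁻ w = Any.reverse⁻ ∘ subst (_ ∈_) (edgesOf-reverseWalk w)

-- Reversal (reverse G) maps walks of Gᴿ back to walks of G: reverse (reverse G) is G up to record η.
open Reversal

reverse-StronglyConnected : ∀ G → StronglyConnected G → StronglyConnected (reverse G)
reverse-StronglyConnected G sc x y = reverseWalk G (sc y x)

reverse-ReachWithout : ∀ G {e x y} → ReachWithout G e x y → ReachWithout (reverse G) e y x
reverse-ReachWithout G (w , e∉w) = reverseWalk G w , e∉w ∘ ∈-edgesOf-reverseWalk⁻ G w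

reverse-OnEveryPath : ∀ G {x y f} → OnEveryPath G x y f → OnEveryPath (reverse G) y x f
reverse-OnEveryPath G oe w u =
  ∈-edgesOf-reverseWalk⁻ (reverse G) w (oe (reverseWalk (reverse G) w) (reverseWalk-IsPath (reverse G) w u))

first⇒last-reverse : ∀ G {x y e} → IsFirstOnEveryPath G x y e → IsLastOnEveryPath (reverse G) y x e
first⇒last-reverse G {x} {y} {e} (oe , first) = reverse-OnEveryPath G oe , last
  where
    last : ∀ (w : Walk (reverse G) y x) → IsPath w →
           ∃[ p₁ ] ∃[ p₂ ] (edgesOf w ≡ p₁ ++ e ∷ p₂ × (∀ f → OnEveryPath (reverse G) y x f → f ∉ p₂))
    last w u with first (reverseWalk (reverse G) w) (reverseWalk-IsPath (reverse G) w u)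
    ... | r₁ , r₂ , edges≡ , r₁-free =
      List.reverse r₂ , List.reverse r₁ , reversed ,
      λ f oe-f → r₁-free f (reverse-OnEveryPath (reverse G) oe-f) ∘ Any.reverse⁻
      where
        open ≡-Reasoning
        reversed : edgesOf w ≡ List.reverse r₂ ++ e ∷ List.reverse r₁
        reversed = begin
          edgesOf w                                          ≡⟨ reverse-involutive (edgesOf w) ⟨
          List.reverse (List.reverse (edgesOf w))            ≡⟨ cong List.reverse (edgesOf-reverseWalk (reverse G) w) ⟨
          List.reverse (edgesOf (reverseWalk (reverse G) w)) ≡⟨ cong List.reverse edges≡ ⟩
          List.reverse (r₁ ++ e ∷ r₂)                        ≡⟨ reverse-++ r₁ (e ∷ r₂) ⟩
          List.reverse (e ∷ r₂) ++ List.reverse r₁           ≡⟨ cong (_++ List.reverse r₁) (unfold-reverse e r₂) ⟩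
          (List.reverse r₂ ++ e ∷ []) ++ List.reverse r₁     ≡⟨ ++-assoc (List.reverse r₂) (e ∷ []) (List.reverse r₁) ⟩
          List.reverse r₂ ++ e ∷ List.reverse r₁             ∎

lemma16 : (G : Digraph) → StronglyConnected G → (s u v : V G) →
    (∀ (ev : E G) → IsLastOnEveryPath G s v ev →
       ReachWithout G ev u v ⇔ AuxReach G s u v)
    × (∀ (eu : E G) → IsFirstOnEveryPath G u s eu →
       ReachWithout G eu u v ⇔ AuxReach (reverse G) s v u)
lemma16 G sc s u v = last-edge , first-edge
  where
    last-edge : ∀ ev → IsLastOnEveryPath G s v ev → ReachWithout G ev u v ⇔ AuxReach G s u v
    last-edge ev last = LastEdge.reachWithout⇔auxReach G s (sc s) v ev last u

    first-edge : ∀ eu → IsFirstOnEveryPath G u s eu → ReachWithout G eu u v ⇔ AuxReach (reverse G) s v u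
    first-edge eu first =
      LastEdge.reachWithout⇔auxReach (reverse G) s (reverse-StronglyConnected G sc s) u eu
        (first⇒last-reverse G first) v
      ⇔-∘ mk⇔ (reverse-ReachWithout G) (reverse-ReachWithout (reverse G))
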